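{- Let $N$ be the size of the ID space. Let $\mathcal{A}$ be a deterministic leader election algorithm in the $\mathsf{Strong}\text{ - }\mathsf{CD}$ model that is correct for every set of devices $V \subseteq [N]$ with $|V| = 2$. Let $k$ be its energy complexity and $t$ its time complexity. Then $t \geq \Omega(k N^{1/k})$.
   Context: Single-hop radio network: a set $V$ of devices, each device $v$ having a distinct identifier $\mathsf{ID}(v) \in [N] = \{1,\dots,N\}$; $N$ is known to all devices. Communication proceeds in synchronous time slots; in each slot each device (based on its ID, the known parameters and all feedback received so far) either stays idle, listens, or transmits a message. In the $\mathsf{Strong}\text{ - }\mathsf{CD}$ model, transmitters and listeners receive silence if zero devices transmit, collision if at least two devices transmit, and the message if exactly one device transmits; idle devices receive nothing. Leader election: at termination exactly one device identifies itself as leader and all others as non-leaders. The time complexity is the worst-case number of time slots; the energy complexity is the worst-case maximum over all devices of the number of time slots in which the device listens or transmits. -}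

module Defs where

open import Data.Nat using (ℕ; zero; suc; _+_; _≤_)
open import Data.Fin using (Fin)
open import Data.Bool using (Bool; true; false)
open import Data.List using (List; []; _∷_)
open import Data.Product using (_×_; ∃; _,_)
open import Data.Sum using (_⊎_)
open import Relation.Binary.PropositionalEquality using (_≡_; _≢_)

-- Devices are identified by their ID in [N] = {1..N}, represented as Fin N
-- (ID i+1 ↦ i).  M is the type of messages.

-- What a device does in a time slot.  `halt b` means: the device has
-- terminated, declaring itself leader (b = true) or non-leader (b = false);
-- halting is not a slot in which the device listens or transmits.
data Action (M : Set) : Set where
  idle     : Action M
  listen   : Action M
  transmit : M → Action M
  halt     : Bool → Action M

-- Feedback a device receives in one slot (`nothing-received` for idle slots).
data Feedback (M : Set) : Set where
  nothing-received : Feedback M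
  silence          : Feedback M
  collision        : Feedback M
  heard            : M → Feedback M

-- Feedback history, most recent slot first (its length is the slot number).
History : Set → Set
History M = List (Feedback M)

Algorithm : ℕ → Set → Set
Algorithm N M = Fin N → History M → Action M

data State (M : Set) : Set where
  running : History M → State M
  done    : Bool → State M

module Execution {N : ℕ} {M : Set} (A : Algorithm N M) (V : List (Fin N)) where

  Config : Set
  Config = Fin N → State M

  actionOf : Fin N → State M → Action M
  actionOf v (running h) = A v h
  actionOf v (done b)    = halt b

  transmitted : Config → List (Fin N) → List M
  transmitted σ []      = []
  transmitted σ (v ∷ W) with actionOf v (σ v)
  ... | transmit m = m ∷ transmitted σ W
  ... | _          = transmitted σ W

  channel : List M → Feedback M
  channel []          = silence
  channel (m ∷ [])    = heard m
  channel (_ ∷ _ ∷ _) = collision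

  update : Fin N → State M → Feedback M → State M
  update v (done b)    f = done b
  update v (running h) f with A v h
  ... | idle       = running (nothing-received ∷ h)
  ... | listen     = running (f ∷ h)
  ... | transmit _ = running (f ∷ h)
  ... | halt b     = done b

  -- configuration at the beginning of slot s (s = 0, 1, 2, ...)
  config : ℕ → Config
  config zero    v = running []
  config (suc s) v = update v (config s v) (channel (transmitted (config s) V))

  actionAt : ℕ → Fin N → Action M
  actionAt s v = actionOf v (config s v)

  -- device v has terminated (with output b) by the beginning of slot s,
  -- i.e. after using at most s time slots
  HaltedWith : ℕ → Fin N → Bool → Set
  HaltedWith s v b = actionAt s v ≡ halt b

  isActive : Action M → ℕ
  isActive listen       = 1
  isActive (transmit _) = 1
  isActive _            = 0

  energy : ℕ → Fin N → ℕ
  energy zero    v = 0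
  energy (suc s) v = isActive (actionAt s v) + energy s v

module Pair {N : ℕ} {M : Set} (A : Algorithm N M) (a b : Fin N) =
  Execution A (a ∷ b ∷ [])

AllHalted : ∀ {N M} → Algorithm N M → Fin N → Fin N → ℕ → Set
AllHalted A a b s =
  ∃ (λ x → Pair.HaltedWith A a b s a x) × ∃ (λ y → Pair.HaltedWith A a b s b y)

ExactlyOneLeader : ∀ {N M} → Algorithm N M → Fin N → Fin N → ℕ → Set
ExactlyOneLeader A a b s =
  (Pair.HaltedWith A a b s a true  × Pair.HaltedWith A a b s b false)
  ⊎ (Pair.HaltedWith A a b s a false × Pair.HaltedWith A a b s b true)

CorrectOnPairs : ∀ {N M} → Algorithm N M → Set
CorrectOnPairs {N} A = ∀ (a b : Fin N) → a ≢ b →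
  ∃ λ s → AllHalted A a b s × ExactlyOneLeader A a b s

TimeComplexity : ∀ {N M} → Algorithm N M → ℕ → Set
TimeComplexity {N} A t =
  (∀ (a b : Fin N) → a ≢ b → AllHalted A a b t) ×
  (∀ t' → (∀ (a b : Fin N) → a ≢ b → AllHalted A a b t') → t ≤ t')

-- k is the energy complexity: the worst case (over all V with |V| = 2 and
-- all v ∈ V) number of slots in which v listens or transmits, measured over
-- the first t slots, t being the time complexity
EnergyComplexity : ∀ {N M} → Algorithm N M → ℕ → ℕ → Set
EnergyComplexity {N} A t k =
  (∀ (a b : Fin N) → a ≢ b →
     (Pair.energy A a b t a ≤ k) × (Pair.energy A a b t b ≤ k)) ×
  ∃ (λ a → ∃ λ b → a ≢ b × (Pair.energy A a b t a ≡ k))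

-- Run each device v alone "with a twin": a copy of itself, so that when v listens it hears
-- silence and when it transmits it hears a collision.  This run depends on v only, and its
-- mode trace (passive / listening / transmitting per slot) over the first t slots has at
-- most k active slots.  If two devices a, b had the same trace and the same final output
-- in their twin runs, then in the real run on {a, b} each would receive exactly the
-- feedback of its twin run (both listen: silence; both transmit: collision), so both
-- would declare the same output, contradicting leader election.  Hence N is at most
-- twice the number of such traces, which is at most (2(t + k))^k / k!; together with
-- k^k ≤ 4^k k! and k ≤ t this gives k^k N ≤ (32 t)^k.

module Submission where

open import Defs
open import Data.Bool using (Bool; false)
open import Data.Fin using (Fin; zero; _↑ˡ_; _↑ʳ_; splitAt; combine; _≟_)
open import Data.Fin.Properties
  using (↑ˡ-injective; ↑ʳ-injective; splitAt-↑ˡ; splitAt-↑ʳ; combine-injective; injective⇒≤; 2↔Bool)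
open import Data.List using (List; []; _∷_; _++_)
open import Data.List.Properties using (++-identityʳ)
open import Data.Nat hiding (_≟_)
open import Data.Nat.Properties hiding (_≟_)
open import Data.Nat.Tactic.RingSolver using (solve; solve-∀)
open import Algebra.Properties.CommutativeSemigroup *-commutativeSemigroup
  using (interchange; x∙yz≈y∙xz; xy∙z≈y∙xz)
open import Data.Product using (∃; _×_; _,_; proj₁; proj₂)
open import Data.Sum using (inj₁; inj₂; [_,_]′)
open import Function using (_∘_; const; _↣_)
open import Function.Bundles using (Injection)
open import Function.Definitions using (Injective)
open import Function.Properties.Inverse using (↔-sym; ↔⇒↣)
open import Relation.Binary.PropositionalEquality
open import Relation.Nullary using (yes; no; contradiction)

-- Elementary inequalities

^-distribʳ-* : ∀ m n k → (m * n) ^ k ≡ m ^ k * n ^ k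
^-distribʳ-* m n zero    = refl
^-distribʳ-* m n (suc k) = begin
  m * n * (m * n) ^ k     ≡⟨ cong (m * n *_) (^-distribʳ-* m n k) ⟩
  m * n * (m ^ k * n ^ k) ≡⟨ interchange m n (m ^ k) (n ^ k) ⟩
  m ^ suc k * n ^ suc k   ∎
  where open ≡-Reasoning

n!≤n^n : ∀ n → n ! ≤ n ^ n
n!≤n^n zero    = ≤-refl
n!≤n^n (suc n) = *-monoʳ-≤ (suc n) (≤-trans (n!≤n^n n) (^-monoˡ-≤ n (n≤1+n n)))

bernoulli-step : ∀ n j → suc n * (n ∸ suc j) ≤ n * (n ∸ j)
bernoulli-step zero    j       = z≤n
bernoulli-step (suc n) zero    = begin
  suc (suc n) * n        ≤⟨ n≤1+n _ ⟩
  suc (suc (suc n) * n)  ≡⟨ solve (n ∷ []) ⟩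
  suc n * suc n          ∎
  where open ≤-Reasoning
bernoulli-step (suc n) (suc j) = +-mono-≤ (∸-monoʳ-≤ n (n≤1+n j)) (bernoulli-step n j)

-- (1 + 1/n)^j ≤ n / (n - j), cleared of denominators.
bernoulli : ∀ n j → suc n ^ j * (n ∸ j) ≤ n ^ suc j
bernoulli n zero    = ≤-reflexive (*-comm 1 n)
bernoulli n (suc j) = begin
  suc n * suc n ^ j * (n ∸ suc j)   ≡⟨ xy∙z≈y∙xz (suc n) (suc n ^ j) (n ∸ suc j) ⟩
  suc n ^ j * (suc n * (n ∸ suc j)) ≤⟨ *-monoʳ-≤ (suc n ^ j) (bernoulli-step n j) ⟩
  suc n ^ j * (n * (n ∸ j))         ≡⟨ x∙yz≈y∙xz (suc n ^ j) n (n ∸ j) ⟩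
  n * (suc n ^ j * (n ∸ j))         ≤⟨ *-monoʳ-≤ n (bernoulli n j) ⟩
  n ^ suc (suc j)                   ∎
  where open ≤-Reasoning

-- (1 + 1/(2k))^k ≤ 2
half-compound-interest : ∀ k .{{_ : NonZero k}} → suc (k + k) ^ k ≤ 2 * (k + k) ^ k
half-compound-interest k = *-cancelʳ-≤ _ _ k (begin
  suc (k + k) ^ k * k             ≡⟨ cong (suc (k + k) ^ k *_) (sym (m+n∸m≡n k k)) ⟩
  suc (k + k) ^ k * (k + k ∸ k)   ≤⟨ bernoulli (k + k) k ⟩
  (k + k) * (k + k) ^ k           ≡⟨ doubling k ((k + k) ^ k) ⟩
  2 * (k + k) ^ k * k             ∎)
  where
  open ≤-Reasoning
  doubling : ∀ k x → (k + k) * x ≡ 2 * x * k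
  doubling = solve-∀

-- (1 + 1/k)^k ≤ 4, via (1 + 1/k) ≤ (1 + 1/(2k))^2.
compound-interest : ∀ k → suc k ^ k ≤ 4 * k ^ k
compound-interest zero        = s≤s z≤n
compound-interest k@(suc _)   = *-cancelʳ-≤ _ _ (D ^ k * D ^ k) {{m*n≢0 _ _ {{m^n≢0 D k}} {{m^n≢0 D k}}}} (begin
  suc k ^ k * (D ^ k * D ^ k)         ≡⟨ cong (suc k ^ k *_) (sym (^-distribʳ-* D D k)) ⟩
  suc k ^ k * (D * D) ^ k             ≡⟨ sym (^-distribʳ-* (suc k) (D * D) k) ⟩
  (suc k * (D * D)) ^ k               ≤⟨ ^-monoˡ-≤ k (one-over-k≤twice-one-over-2k k) ⟩
  (suc D * suc D * k) ^ k             ≡⟨ ^-distribʳ-* (suc D * suc D) k k ⟩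
  (suc D * suc D) ^ k * k ^ k         ≡⟨ cong (_* k ^ k) (^-distribʳ-* (suc D) (suc D) k) ⟩
  suc D ^ k * suc D ^ k * k ^ k       ≤⟨ *-monoˡ-≤ (k ^ k) (*-mono-≤ (half-compound-interest k) (half-compound-interest k)) ⟩
  2 * D ^ k * (2 * D ^ k) * k ^ k     ≡⟨ regroup (D ^ k) (k ^ k) ⟩
  4 * k ^ k * (D ^ k * D ^ k)         ∎)
  where
  open ≤-Reasoning
  D = k + k
  one-over-k≤twice-one-over-2k : ∀ k → suc k * ((k + k) * (k + k)) ≤ suc (k + k) * suc (k + k) * k
  one-over-k≤twice-one-over-2k k = ≤-trans (m≤m+n _ k) (≤-reflexive (expand k))
    where
    expand : ∀ k → suc k * ((k + k) * (k + k)) + k ≡ suc (k + k) * suc (k + k) * k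
    expand = solve-∀
  regroup : ∀ x y → 2 * x * (2 * x) * y ≡ 4 * y * (x * x)
  regroup = solve-∀

k^k≤4^k*k! : ∀ k → k ^ k ≤ 4 ^ k * k !
k^k≤4^k*k! zero    = ≤-refl
k^k≤4^k*k! (suc k) = begin
  suc k * suc k ^ k               ≤⟨ *-monoʳ-≤ (suc k) (compound-interest k) ⟩
  suc k * (4 * k ^ k)             ≤⟨ *-monoʳ-≤ (suc k) (*-monoʳ-≤ 4 (k^k≤4^k*k! k)) ⟩
  suc k * (4 * (4 ^ k * k !))     ≡⟨ regroup (suc k) (4 ^ k) (k !) ⟩
  4 * 4 ^ k * (suc k * k !)       ∎
  where
  open ≤-Reasoning
  regroup : ∀ a b c → a * (4 * (b * c)) ≡ 4 * b * (a * c)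
  regroup = solve-∀

-- The first two terms of the binomial expansion of (x + d)^(n+1).
binomial-lower-bound : ∀ n x d → x ^ suc n + suc n * d * x ^ n ≤ (x + d) ^ suc n
binomial-lower-bound zero    x d = ≤-reflexive (linear x d)
  where
  linear : ∀ x d → x * 1 + 1 * d * 1 ≡ (x + d) * 1
  linear = solve-∀
binomial-lower-bound (suc n) x d = begin
  x * x ^ suc n + suc (suc n) * d * x ^ suc n                           ≤⟨ m≤m+n _ _ ⟩
  x * x ^ suc n + suc (suc n) * d * x ^ suc n + d * (suc n * d * x ^ n) ≡⟨ expand n x d (x ^ n) ⟩
  (x + d) * (x ^ suc n + suc n * d * x ^ n)                             ≤⟨ *-monoʳ-≤ (x + d) (binomial-lower-bound n x d) ⟩
  (x + d) ^ suc (suc n)                                                 ∎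
  where
  open ≤-Reasoning
  expand : ∀ n x d p → x * (x * p) + suc (suc n) * d * (x * p) + d * (suc n * d * p)
                     ≡ (x + d) * (x * p + suc n * d * p)
  expand = solve-∀

-- Mode words with an energy budget

data Mode : Set where
  passive listening transmitting : Mode

cost : Mode → ℕ
cost passive      = 0
cost listening    = 1
cost transmitting = 1

activeSlots : (ℕ → Mode) → ℕ → ℕ
activeSlots f zero    = 0
activeSlots f (suc s) = cost (f s) + activeSlots f s

activeSlots-suc : ∀ f s → activeSlots f (suc s) ≡ cost (f 0) + activeSlots (f ∘ suc) s
activeSlots-suc f zero    = refl
activeSlots-suc f (suc s) = begin
  cost (f (suc s)) + activeSlots f (suc s)                   ≡⟨ cong (cost (f (suc s)) +_) (activeSlots-suc f s) ⟩
  cost (f (suc s)) + (cost (f 0) + activeSlots (f ∘ suc) s)  ≡⟨ x+[y+z]≡y+[x+z] (cost (f (suc s))) (cost (f 0)) _ ⟩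
  cost (f 0) + activeSlots (f ∘ suc) (suc s)                 ∎
  where open ≡-Reasoning
        x+[y+z]≡y+[x+z] : ∀ x y z → x + (y + z) ≡ y + (x + z)
        x+[y+z]≡y+[x+z] = solve-∀

exhausted-budget : ∀ f s → activeSlots f (suc s) ≤ 0 → f s ≡ passive
exhausted-budget f s ≤0 with f s | m+n≤o⇒m≤o (cost (f s)) ≤0
... | passive      | _  = refl
... | listening    | ()
... | transmitting | ()

remaining-budget : ∀ f s r → activeSlots f (suc s) ≤ r → activeSlots (f ∘ suc) s ≤ r ∸ cost (f 0)
remaining-budget f s r ≤r =
  m+n≤o⇒m≤o∸n _ (≤-trans (≤-reflexive (+-comm _ (cost (f 0)))) (subst (_≤ r) (activeSlots-suc f s) ≤r))

AgreeBelow : {A : Set} → ℕ → (ℕ → A) → (ℕ → A) → Set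
AgreeBelow s f g = ∀ {i} → i < s → f i ≡ g i

agreeBelow-suc : ∀ {A : Set} {s} {f g : ℕ → A} → AgreeBelow s f g → f s ≡ g s → AgreeBelow (suc s) f g
agreeBelow-suc agree fs≡gs i<1+s with m<1+n⇒m<n∨m≡n i<1+s
... | inj₁ i<s  = agree i<s
... | inj₂ refl = fs≡gs

-- Words of length t over Mode with at most r active letters.
schedules : ℕ → ℕ → ℕ
schedules zero    r       = 1
schedules (suc t) zero    = 1
schedules (suc t) (suc r) = schedules t (suc r) + (schedules t r + schedules t r)

schedules-zero : ∀ t → schedules t 0 ≡ 1
schedules-zero zero    = refl
schedules-zero (suc t) = refl

schedules-bound : ∀ t r → r ! * schedules t r ≤ (2 * (t + r)) ^ r
schedules-bound zero    r       = begin
  r ! * 1          ≡⟨ *-identityʳ (r !) ⟩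
  r !              ≤⟨ n!≤n^n r ⟩
  r ^ r            ≤⟨ ^-monoˡ-≤ r (m≤n*m r 2) ⟩
  (2 * r) ^ r      ∎
  where open ≤-Reasoning
schedules-bound (suc t) zero    = ≤-refl
schedules-bound (suc t) (suc r) = begin
  suc r ! * (schedules t (suc r) + (schedules t r + schedules t r))  ≡⟨ split (suc r) (r !) _ _ ⟩
  suc r ! * schedules t (suc r) + suc r * 2 * (r ! * schedules t r)  ≤⟨ +-mono-≤ (schedules-bound t (suc r)) (*-monoʳ-≤ (suc r * 2) shorter) ⟩
  Y ^ suc r + suc r * 2 * Y ^ r                                      ≤⟨ binomial-lower-bound r Y 2 ⟩
  (Y + 2) ^ suc r                                                    ≡⟨ cong (_^ suc r) (shift t r) ⟩
  (2 * (suc t + suc r)) ^ suc r                                      ∎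
  where
  open ≤-Reasoning
  Y = 2 * (t + suc r)
  shorter : r ! * schedules t r ≤ Y ^ r
  shorter = ≤-trans (schedules-bound t r) (^-monoˡ-≤ r (*-monoʳ-≤ 2 (+-monoʳ-≤ t (n≤1+n r))))
  split : ∀ a b p q → a * b * (p + (q + q)) ≡ a * b * p + a * 2 * (b * q)
  split = solve-∀
  shift : ∀ t r → 2 * (t + suc r) + 2 ≡ 2 * (suc t + suc r)
  shift = solve-∀

-- Codes of words starting with a passive, listening or transmitting letter occupy three
-- consecutive blocks.
step : ∀ t r (m : Mode) → Fin (schedules t (suc r ∸ cost m)) → Fin (schedules (suc t) (suc r))
step t r passive      x = x ↑ˡ (schedules t r + schedules t r)
step t r listening    x = schedules t (suc r) ↑ʳ (x ↑ˡ schedules t r)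
step t r transmitting x = schedules t (suc r) ↑ʳ (schedules t r ↑ʳ x)

firstLetter : ∀ t r → Fin (schedules (suc t) (suc r)) → Mode
firstLetter t r i =
  [ const passive , [ const listening , const transmitting ]′ ∘ splitAt (schedules t r) ]′
    (splitAt (schedules t (suc r)) i)

firstLetter-step : ∀ t r m x → firstLetter t r (step t r m x) ≡ m
firstLetter-step t r passive x
  rewrite splitAt-↑ˡ (schedules t (suc r)) x (schedules t r + schedules t r) = refl
firstLetter-step t r listening x
  rewrite splitAt-↑ʳ (schedules t (suc r)) (schedules t r + schedules t r) (x ↑ˡ schedules t r)
        | splitAt-↑ˡ (schedules t r) x (schedules t r) = refl
firstLetter-step t r transmitting x
  rewrite splitAt-↑ʳ (schedules t (suc r)) (schedules t r + schedules t r) (schedules t r ↑ʳ x)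
        | splitAt-↑ʳ (schedules t r) (schedules t r) x = refl

step-injective : ∀ t r m {x y} → step t r m x ≡ step t r m y → x ≡ y
step-injective t r passive      e = ↑ˡ-injective _ _ _ e
step-injective t r listening    e = ↑ˡ-injective _ _ _ (↑ʳ-injective _ _ _ e)
step-injective t r transmitting e = ↑ʳ-injective (schedules t r) _ _ (↑ʳ-injective (schedules t (suc r)) _ _ e)

encode : ∀ t r → (ℕ → Mode) → Fin (schedules t r)
encode zero    r       f = zero
encode (suc t) zero    f = zero
encode (suc t) (suc r) f = step t r (f 0) (encode t (suc r ∸ cost (f 0)) (f ∘ suc))

encode-step : ∀ t r f {m} → f 0 ≡ m → encode (suc t) (suc r) f ≡ step t r m (encode t (suc r ∸ cost m) (f ∘ suc))
encode-step t r f refl = refl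

encode-determines : ∀ t r (f g : ℕ → Mode) {s} → s < t → AgreeBelow s f g →
  activeSlots f (suc s) ≤ r → activeSlots g (suc s) ≤ r → encode t r f ≡ encode t r g → f s ≡ g s
encode-determines t       zero    f g {s} _ _ f≤0 g≤0 _ =
  trans (exhausted-budget f s f≤0) (sym (exhausted-budget g s g≤0))
encode-determines (suc t) (suc r) f g {zero}  _ _ _ _ e =
  trans (sym (firstLetter-step t r (f 0) _)) (trans (cong (firstLetter t r) e) (firstLetter-step t r (g 0) _))
encode-determines (suc t) (suc r) f g {suc s} (s≤s s<t) agree f≤ g≤ e =
  encode-determines t (suc r ∸ cost (g 0)) (f ∘ suc) (g ∘ suc) s<t (agree ∘ s≤s)
    (subst (λ m → activeSlots (f ∘ suc) (suc s) ≤ suc r ∸ cost m) f0≡g0 (remaining-budget f (suc s) (suc r) f≤))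
    (remaining-budget g (suc s) (suc r) g≤)
    (step-injective t r (g 0) (trans (sym (encode-step t r f f0≡g0)) e))
  where
  f0≡g0 : f 0 ≡ g 0
  f0≡g0 = agree (s≤s z≤n)

-- Executions

mode : ∀ {M} → Action M → Mode
mode listen       = listening
mode (transmit _) = transmitting
mode idle         = passive
mode (halt _)     = passive

sent : ∀ {M} → Action M → List M
sent (transmit m) = m ∷ []
sent _            = []

-- The feedback when both devices of a pair act in the given mode (never used when passive).
echo : ∀ {M} → Mode → Feedback M
echo transmitting = collision
echo _            = silence

output : ∀ {M} → Action M → Bool
output (halt b) = b
-- junk value for devices that have not terminated
output _        = false

module Run {N : ℕ} {M : Set} (A : Algorithm N M) (V : List (Fin N)) where
  open Execution A V

  isActive-mode : ∀ α → isActive α ≡ cost (mode α)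
  isActive-mode idle         = refl
  isActive-mode listen       = refl
  isActive-mode (transmit _) = refl
  isActive-mode (halt _)     = refl

  transmitted-∷ : ∀ σ v W → transmitted σ (v ∷ W) ≡ sent (actionOf v (σ v)) ++ transmitted σ W
  transmitted-∷ σ v W with actionOf v (σ v)
  ... | idle       = refl
  ... | listen     = refl
  ... | transmit _ = refl
  ... | halt _     = refl

  channel-sameMode : ∀ α β → mode α ≡ mode β → channel (sent α ++ sent β) ≡ echo (mode α)
  channel-sameMode idle         idle         _  = refl
  channel-sameMode idle         (halt _)     _  = refl
  channel-sameMode (halt _)     idle         _  = refl
  channel-sameMode (halt _)     (halt _)     _  = refl
  channel-sameMode listen       listen       _  = refl
  channel-sameMode (transmit _) (transmit _) _  = refl
  channel-sameMode idle         listen       ()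
  channel-sameMode idle         (transmit _) ()
  channel-sameMode (halt _)     listen       ()
  channel-sameMode (halt _)     (transmit _) ()
  channel-sameMode listen       idle         ()
  channel-sameMode listen       (halt _)     ()
  channel-sameMode listen       (transmit _) ()
  channel-sameMode (transmit _) idle         ()
  channel-sameMode (transmit _) listen       ()
  channel-sameMode (transmit _) (halt _)     ()

  pair-feedback : ∀ σ a b → mode (actionOf a (σ a)) ≡ mode (actionOf b (σ b)) →
    channel (transmitted σ (a ∷ b ∷ [])) ≡ echo (mode (actionOf a (σ a)))
  pair-feedback σ a b same = begin
    channel (transmitted σ (a ∷ b ∷ []))     ≡⟨ cong channel (transmitted-∷ σ a (b ∷ [])) ⟩
    channel (sent α ++ transmitted σ (b ∷ [])) ≡⟨ cong (λ l → channel (sent α ++ l)) (trans (transmitted-∷ σ b []) (++-identityʳ _)) ⟩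
    channel (sent α ++ sent β)               ≡⟨ channel-sameMode α β same ⟩
    echo (mode α)                            ∎
    where
    open ≡-Reasoning
    α = actionOf a (σ a)
    β = actionOf b (σ b)

  halted-persists : ∀ {s v x} → HaltedWith s v x → HaltedWith (suc s) v x
  halted-persists {s} {v} h with config s v
  ... | done _ = h
  ... | running hist with A v hist
  ...   | halt _ = h

  halted-persists-≤ : ∀ {s s' v x} → s ≤ s' → HaltedWith s v x → HaltedWith s' v x
  halted-persists-≤ {s} {v = v} {x} s≤s' h = subst (λ u → HaltedWith u v x) (m∸n+n≡m s≤s') (later (_ ∸ s))
    where
    later : ∀ d → HaltedWith (d + s) v x
    later zero    = h
    later (suc d) = halted-persists {d + s} (later d)

  output-unique : ∀ {s s' v x y} → HaltedWith s v x → HaltedWith s' v y → x ≡ y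
  output-unique {s} {s'} hx hy with ≤-total s s'
  ... | inj₁ s≤s' = cong output (trans (sym (halted-persists-≤ s≤s' hx)) hy)
  ... | inj₂ s'≤s = cong output (trans (sym hx) (halted-persists-≤ s'≤s hy))

  energy-mono : ∀ {s s'} v → s ≤ s' → energy s v ≤ energy s' v
  energy-mono {s' = zero}   v z≤n = z≤n
  energy-mono {s' = suc s'} v s≤s' with m≤n⇒m<n∨m≡n s≤s'
  ... | inj₁ (s≤s s≤s'') = ≤-trans (energy-mono v s≤s'') (m≤n+m _ _)
  ... | inj₂ refl        = ≤-refl

  energy≤slots : ∀ s v → energy s v ≤ s
  energy≤slots zero    v = z≤n
  energy≤slots (suc s) v = +-mono-≤ (isActive≤1 (actionAt s v)) (energy≤slots s v)
    where
    isActive≤1 : ∀ α → isActive α ≤ 1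
    isActive≤1 idle         = z≤n
    isActive≤1 listen       = ≤-refl
    isActive≤1 (transmit _) = ≤-refl
    isActive≤1 (halt _)     = z≤n

-- Twin and pair runs

module Simulation {N : ℕ} {M : Set} (A : Algorithm N M) where

  module Twin (v : Fin N) = Execution A (v ∷ v ∷ [])

  trace : Fin N → ℕ → Mode
  trace v s = mode (Twin.actionAt v s v)

  finalOutput : ℕ → Fin N → Bool
  finalOutput t v = output (Twin.actionAt v t v)

  twin-step : ∀ v s → Twin.config v (suc s) v ≡ Twin.update v v (Twin.config v s v) (echo (trace v s))
  twin-step v s = cong (Twin.update v v (Twin.config v s v)) (Run.pair-feedback A (v ∷ v ∷ []) (Twin.config v s) v v refl)

  -- `actionOf`, `update` and `channel` do not use the device set, so they are definitionally
  -- the same in the pair run and in the twin runs; the proofs below rely on this.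
  module _ (a b : Fin N) where
    open Pair A a b
    open Run A (a ∷ b ∷ [])

    follows-twin : ∀ v s → config s v ≡ Twin.config v s v →
      channel (transmitted (config s) (a ∷ b ∷ [])) ≡ echo (mode (actionAt s v)) →
      config (suc s) v ≡ Twin.config v (suc s) v
    follows-twin v s same-state feedback = begin
      config (suc s) v                                          ≡⟨ cong (update v (config s v)) feedback ⟩
      update v (config s v) (echo (mode (actionAt s v)))         ≡⟨ cong (λ st → update v st (echo (mode (actionOf v st)))) same-state ⟩
      update v (Twin.config v s v) (echo (trace v s))            ≡⟨ sym (twin-step v s) ⟩
      Twin.config v (suc s) v                                   ∎
      where open ≡-Reasoning

    simulation : ∀ {s} → AgreeBelow s (trace a) (trace b) →
      config s a ≡ Twin.config a s a × config s b ≡ Twin.config b s b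
    simulation {zero}  _     = refl , refl
    simulation {suc s} agree =
        follows-twin a s ea (pair-feedback (config s) a b same)
      , follows-twin b s eb (trans (pair-feedback (config s) a b same) (cong echo same))
      where
      ea = proj₁ (simulation (agree ∘ m<n⇒m<1+n))
      eb = proj₂ (simulation (agree ∘ m<n⇒m<1+n))
      same : mode (actionAt s a) ≡ mode (actionAt s b)
      same = trans (cong (mode ∘ actionOf a) ea) (trans (agree ≤-refl) (cong (mode ∘ actionOf b) (sym eb)))

    energy-traced : ∀ v s → (∀ {i} → i ≤ s → config i v ≡ Twin.config v i v) →
      energy (suc s) v ≡ activeSlots (trace v) (suc s)
    energy-traced v s same = cong₂ _+_
      (trans (cong (isActive ∘ actionOf v) (same ≤-refl)) (isActive-mode _))
      (earlier s same)
      where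
      earlier : ∀ s → (∀ {i} → i ≤ s → config i v ≡ Twin.config v i v) → energy s v ≡ activeSlots (trace v) s
      earlier zero    _    = refl
      earlier (suc s) same = energy-traced v s (same ∘ m≤n⇒m≤1+n)

    simulation-≤ : ∀ {s i} → AgreeBelow s (trace a) (trace b) → i ≤ s →
      config i a ≡ Twin.config a i a × config i b ≡ Twin.config b i b
    simulation-≤ agree i≤s = simulation (λ j<i → agree (<-≤-trans j<i i≤s))

    traced-budget : ∀ {s t k} v → (∀ {i} → i ≤ s → config i v ≡ Twin.config v i v) →
      s < t → energy t v ≤ k → activeSlots (trace v) (suc s) ≤ k
    traced-budget {s} {k = k} v same s<t e≤k =
      subst (_≤ k) (energy-traced v s same) (≤-trans (energy-mono v s<t) e≤k)

    -- The energy bounds are known for the pair run, which follows the twin runs only while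
    -- the traces agree; so agreement is extended one slot at a time.
    agree-upTo : ∀ {t k} → energy t a ≤ k → energy t b ≤ k →
      encode t k (trace a) ≡ encode t k (trace b) → ∀ s → s ≤ t → AgreeBelow s (trace a) (trace b)
    agree-upTo _ _ _ zero _ ()
    agree-upTo {t} {k} ea eb e (suc s) s<t = agreeBelow-suc agree
      (encode-determines t k (trace a) (trace b) s<t agree
        (traced-budget a (proj₁ ∘ simulation-≤ agree) s<t ea)
        (traced-budget b (proj₂ ∘ simulation-≤ agree) s<t eb) e)
      where
      agree = agree-upTo ea eb e s (<⇒≤ s<t)

    leaders-differ : CorrectOnPairs A → a ≢ b → ∀ {t x y} → HaltedWith t a x → HaltedWith t b y → x ≢ y
    leaders-differ correct a≢b {t} hx hy x≡y with correct a b a≢b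
    ... | s , _ , inj₁ (a-leads , b-follows) =
      contradiction (trans (output-unique {s} {t} {a} a-leads hx) (trans x≡y (output-unique {t} {s} {b} hy b-follows))) λ ()
    ... | s , _ , inj₂ (a-follows , b-leads) =
      contradiction (trans (output-unique {s} {t} {a} a-follows hx) (trans x≡y (output-unique {t} {s} {b} hy b-leads))) λ ()

    twins-distinguishable : ∀ {t k} → CorrectOnPairs A → a ≢ b → AllHalted A a b t →
      energy t a ≤ k → energy t b ≤ k → encode t k (trace a) ≡ encode t k (trace b) →
      finalOutput t a ≢ finalOutput t b
    twins-distinguishable {t} correct a≢b ((x , hx) , (y , hy)) ea eb e outputs≡ =
      leaders-differ correct a≢b {t} hx hy (trans (sym (twin-output a (proj₁ sim) hx)) (trans outputs≡ (twin-output b (proj₂ sim) hy)))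
      where
      sim = simulation (agree-upTo ea eb e t ≤-refl)
      twin-output : ∀ v {z} → config t v ≡ Twin.config v t v → HaltedWith t v z → finalOutput t v ≡ z
      twin-output v same h = cong output (trans (cong (actionOf v) (sym same)) h)

  bit : Bool ↣ Fin 2
  bit = ↔⇒↣ (↔-sym 2↔Bool)

  fingerprint : ∀ t k → Fin N → Fin (2 * schedules t k)
  fingerprint t k v = combine (Injection.to bit (finalOutput t v)) (encode t k (trace v))

  fingerprint-injective : ∀ {t k} → CorrectOnPairs A → TimeComplexity A t → EnergyComplexity A t k →
    Injective _≡_ _≡_ (fingerprint t k)
  fingerprint-injective {t} {k} correct (halted , _) (bounded , _) {a} {b} e with a ≟ b
  ... | yes a≡b = a≡b
  ... | no  a≢b = contradiction (Injection.injective bit (proj₁ codes≡))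
      (twins-distinguishable a b {t} {k} correct a≢b (halted a b a≢b)
        (proj₁ (bounded a b a≢b)) (proj₂ (bounded a b a≢b)) (proj₂ codes≡))
    where
    codes≡ = combine-injective (Injection.to bit (finalOutput t a)) (encode t k (trace a)) _ _ e

  devices≤fingerprints : ∀ {t k} → CorrectOnPairs A → TimeComplexity A t → EnergyComplexity A t k →
    N ≤ 2 * schedules t k
  devices≤fingerprints correct time energy = injective⇒≤ (fingerprint-injective correct time energy)

  energy≤time : ∀ {t k} → EnergyComplexity A t k → k ≤ t
  energy≤time {t} (_ , a , b , _ , energy≡k) = subst (_≤ t) energy≡k (Run.energy≤slots A (a ∷ b ∷ []) t a)

energy-time-tradeoff : ∀ {N t k} → 3 ≤ N → k ≤ t → N ≤ 2 * schedules t k → k ^ k * N ≤ (32 * t) ^ k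
energy-time-tradeoff {N} {t} {zero} 3≤N _ N≤ =
  contradiction (≤-trans 3≤N (subst (λ p → N ≤ 2 * p) (schedules-zero t) N≤)) (n≮n 2)
energy-time-tradeoff {N} {t} {k@(suc k′)} _ k≤t N≤ = begin
  k ^ k * N                           ≤⟨ *-monoʳ-≤ (k ^ k) N≤ ⟩
  k ^ k * (2 * P)                     ≤⟨ *-monoˡ-≤ (2 * P) (k^k≤4^k*k! k) ⟩
  4 ^ k * k ! * (2 * P)               ≡⟨ regroup (4 ^ k) (k !) P ⟩
  2 * 4 ^ k * (k ! * P)               ≤⟨ *-monoʳ-≤ (2 * 4 ^ k) (schedules-bound t k) ⟩
  2 * 4 ^ k * (2 * (t + k)) ^ k       ≤⟨ *-monoʳ-≤ (2 * 4 ^ k) (^-monoˡ-≤ k (*-monoʳ-≤ 2 (+-monoʳ-≤ t k≤t))) ⟩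
  2 * 4 ^ k * (2 * (t + t)) ^ k       ≡⟨ *-assoc 2 (4 ^ k) _ ⟩
  2 * (4 ^ k * (2 * (t + t)) ^ k)     ≡⟨ cong (2 *_) (sym (^-distribʳ-* 4 (2 * (t + t)) k)) ⟩
  2 * (4 * (2 * (t + t))) ^ k         ≤⟨ *-monoˡ-≤ ((4 * (2 * (t + t))) ^ k) (*-monoʳ-≤ 2 (m^n>0 2 k′)) ⟩
  2 ^ k * (4 * (2 * (t + t))) ^ k     ≡⟨ sym (^-distribʳ-* 2 (4 * (2 * (t + t))) k) ⟩
  (2 * (4 * (2 * (t + t)))) ^ k       ≡⟨ cong (_^ k) (sixteen-doublings t) ⟩
  (32 * t) ^ k                        ∎
  where
  open ≤-Reasoning
  P = schedules t k
  regroup : ∀ x y p → x * y * (2 * p) ≡ 2 * x * (y * p)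
  regroup = solve-∀
  sixteen-doublings : ∀ t → 2 * (4 * (2 * (t + t))) ≡ 32 * t
  sixteen-doublings = solve-∀

theorem4p2 : ∃ λ (c : ℕ) → ∃ λ (N₀ : ℕ) →
    ∀ (M : Set) (N : ℕ) → N₀ ≤ N → (A : Algorithm N M) → (k t : ℕ) →
    CorrectOnPairs A → TimeComplexity A t → EnergyComplexity A t k →
    k ^ k * N ≤ (c * t) ^ k
theorem4p2 = 32 , 3 , λ M N 3≤N A k t correct time energy →
  energy-time-tradeoff {N} {t} {k} 3≤N (energy≤time A energy) (devices≤fingerprints A correct time energy)
  where open Simulation
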